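{- Let $b\ge 2$ be an integer, let $f,g:\mathbb{N}\to\mathbb{N}$, and let $\alpha\in[0,1)$ be such that its base $b$ digit sequence is the concatenation $w_1w_2w_3\cdots$, where for each $j\ge 1$ the word $w_j$ has length $g(j)b^{f(j)}$ and is a $b$-ary $(f(j),g(j))$-nested semi-perfect necklace. Then for every $N\in\mathbb{N}$ the star discrepancy $D_N^*$ of the sequence $(\{b^n\alpha\})_{n=0,1,\ldots}$ satisfies $$N D_N^*\le \sum_{j=1}^{m-1} f(j)+\sum_{j=1}^{m} g(j)+(b-1)\frac{f(m)^2}{2}+(b-1)f(m)g(m),$$ where $m\in\mathbb{N}$ is such that $\sum_{j=1}^{m-1} g(j)b^{f(j)}\le N<\sum_{j=1}^{m} g(j)b^{f(j)}$.
   Context: $\{x\}$ denotes the fractional part of $x$. For a sequence $(x_n)_{n\ge0}$ in $[0,1)$, the star discrepancy is $D_N^*=\sup_{0<c\le 1}\left|\frac1N\#\{0\le n<N: x_n\in[0,c)\}-c\right|$. A $b$-ary word is a finite sequence over $\{0,1,\ldots,b-1\}$; a necklace is a word considered up to rotation, so occurrences of subwords are counted circularly (including those wrapping around the end). A $b$-ary necklace is $(k,l)$-semi perfect if its length is $lb^k$ and each word of length $k$ occurs in it (circularly) exactly $l$ times. A $b$-ary word $w$ is a $(k,l)$-nested semi-perfect necklace if for each integer $j\in\{1,\ldots,k\}$, each block of $w$ of length $lb^j$ starting at a position congruent to $1$ modulo $lb^j$ is a $(j,l)$-semi perfect necklace.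
   Formalization: The point c in the supremum defining $D_N^*$ ranges over the rationals in (0,1]. -}

module Defs where

open import Data.Nat using (ℕ; zero; suc; _+_; _*_; _∸_; _^_; _≤_; _<_)
open import Data.Nat.DivMod using (_%_)
open import Data.Fin using (Fin; toℕ)
import Data.Fin as Fin
open import Data.Bool using (Bool; true; false; _∧_)
open import Data.Maybe using (Maybe; just; nothing)
open import Data.List using (List; []; _∷_; length; map; upTo; take; drop)
open import Data.Vec using (Vec; toList)
open import Data.Product using (Σ; _×_; ∃)
open import Relation.Nullary.Decidable using (⌊_⌋)
open import Relation.Binary.PropositionalEquality using (_≡_)
open import Data.Integer using (+_)
import Data.Rational as ℚ
open ℚ using (ℚ)

_!!_ : ∀ {A : Set} → List A → ℕ → Maybe A
[]       !! _       = nothing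
(x ∷ xs) !! zero    = just x
(x ∷ xs) !! (suc i) = xs !! i

-- i mod L, with the (irrelevant) convention i mod 0 = i
modℕ : ℕ → ℕ → ℕ
modℕ i zero    = i
modℕ i (suc L) = i % suc L

circularAt : ∀ {b} → List (Fin b) → ℕ → Maybe (Fin b)
circularAt w i = w !! modℕ i (length w)

eqM : ∀ {b} → Maybe (Fin b) → Fin b → Bool
eqM (just y) x = ⌊ y Fin.≟ x ⌋
eqM nothing  x = false

matchFrom : ∀ {b} → List (Fin b) → List (Fin b) → ℕ → Bool
matchFrom w []       p = true
matchFrom w (x ∷ u)  p = eqM (circularAt w p) x ∧ matchFrom w u (suc p)

countTrue : (ℕ → Bool) → ℕ → ℕ
countTrue P zero = 0
countTrue P (suc n) with P n
... | true  = suc (countTrue P n)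
... | false = countTrue P n

occurrences : ∀ {b} → List (Fin b) → List (Fin b) → ℕ
occurrences w u = countTrue (matchFrom w u) (length w)

SemiPerfect : (b k l : ℕ) → List (Fin b) → Set
SemiPerfect b k l w =
  (length w ≡ l * b ^ k) × ((u : Vec (Fin b) k) → occurrences w (toList u) ≡ l)

-- (k,l)-nested semi-perfect necklace: for each j ∈ {1..k}, every block of
-- length l b^j starting at a position ≡ 1 mod l b^j (1-based), i.e. at
-- 0-based position t * l b^j, is (j,l)-semi perfect.
NestedSemiPerfect : (b k l : ℕ) → List (Fin b) → Set
NestedSemiPerfect b k l w =
  (j : ℕ) → 1 ≤ j → j ≤ k → (t : ℕ) → (suc t) * (l * b ^ j) ≤ length w →
  SemiPerfect b j l (take (l * b ^ j) (drop (t * (l * b ^ j)) w))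

blockEnd : (b : ℕ) → (f g : ℕ → ℕ) → ℕ → ℕ
blockEnd b f g zero    = 0
blockEnd b f g (suc j) = blockEnd b f g j + g (suc j) * b ^ f (suc j)

slice : ∀ {b} → (ℕ → Fin b) → ℕ → ℕ → List (Fin b)
slice d s L = map (λ i → d (s + i)) (upTo L)

block : ∀ {b} → (ℕ → Fin b) → (f g : ℕ → ℕ) → ℕ → List (Fin b)
block {b} d f g j = slice d (blockEnd b f g (j ∸ 1)) (g j * b ^ f j)

sum1 : (ℕ → ℕ) → ℕ → ℕ
sum1 h zero    = 0
sum1 h (suc m) = sum1 h m + h (suc m)

-- The points {b^n α}, where α = Σ_i d_i b^{-i-1} (standard expansion)

-- T d n k = Σ_{i<k} d_{n+i} b^{k-1-i}, so T/b^k is the k-digit truncation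
-- of {b^n α} = 0.d_n d_{n+1} ...
trunc : ∀ {b} → (ℕ → Fin b) → ℕ → ℕ → ℕ
trunc {b} d n zero    = 0
trunc {b} d n (suc k) = trunc d n k * b + toℕ (d (n + k))

ℕtoℚ : ℕ → ℚ
ℕtoℚ n = ℚ._/_ (+ n) 1

-- {b^n α} < c.  Since trunc_k + b^{-k} ≥ {b^n α} and it tends to {b^n α},
-- {b^n α} < c  iff  ∃ k, trunc_k + b^{-k} < c, i.e. (T+1) < c * b^k.
PointBelow : ∀ {b} → (ℕ → Fin b) → ℕ → ℚ → Set
PointBelow {b} d n c = ∃ λ k → ℕtoℚ (suc (trunc d n k)) ℚ.< c ℚ.* ℕtoℚ (b ^ k)

-- the digit sequence is not eventually b-1 (standard base-b expansion)
NotEventuallyMax : ∀ {b} → (ℕ → Fin b) → Set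
NotEventuallyMax {b} d = (∃ λ K → (i : ℕ) → K ≤ i → toℕ (d i) ≡ b ∸ 1) → Data.Empty.⊥
  where import Data.Empty

-- Whether the point {bⁿα} = 0.dₙdₙ₊₁… lies below c is decided by the window
-- dₙ…dₙ₊ᵢ₋₁ of i digits, except when its value is the single boundary value ⌊c bⁱ⌋. In an
-- (i, l)-semi-perfect necklace of length l bⁱ every window occurs exactly l times circularly, so
-- the points it starts contribute l bⁱ c up to an error of i + l: i for the windows running over
-- its end, l for the boundary value. A prefix of an (F, G)-nested necklace splits into at most
-- b - 1 semi-perfect blocks of each level i < F plus a prefix shorter than G, so its error is at
-- most G + (b - 1) Σ_{i<F} (i + G). Adding the errors f(j) + g(j) of the complete words w_j for
-- j < m gives the bound.

module Submission where

open import Defs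
open import Data.Nat using (ℕ; _+_; _*_; _∸_; _^_; _≤_; _<_)
open import Data.Fin using (Fin; toℕ)
open import Data.Fin.Subset using (Subset; _∈_; ∣_∣)
open import Data.Product using (∃)
open import Data.Integer using (+_)
open import Function.Bundles using (_⇔_)
open import Data.Rational as Q using (ℚ)

open import Data.Bool using (Bool; true; false; _∧_)
open import Data.Fin as Fin using (fromℕ<)
import Data.Fin.Properties as Fin
open import Data.Fin.Subset using (inside; outside)
open import Data.Fin.Subset.Properties using (_∈?_)
open import Data.Integer as ℤ using (-[1+_])
import Data.Integer.Properties as ℤ
open import Data.List using (List; length; take; drop; map; applyUpTo; upTo)
import Data.List as List
import Data.List.Properties as List
open import Data.Maybe using (just)
open import Data.Nat as ℕ using (zero; suc; z≤n; s≤s; s≤s⁻¹; NonZero)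
import Data.Nat.Coprimality as Coprime
open import Data.Nat.DivMod
  using (_/_; _%_; m≡m%n+[m/n]*n; m%n<n; m<n*o⇒m/o<n; m<n⇒m%n≡m; [m+kn]%n≡m%n; m/n*n≤m; /-monoˡ-≤; m*n/n≡m)
open import Data.Nat.Properties
open import Algebra.Properties.CommutativeSemigroup +-commutativeSemigroup using ()
  renaming (interchange to +-interchange)
open import Algebra.Properties.CommutativeSemigroup *-commutativeSemigroup using ()
  renaming (xy∙z≈xz∙y to [xy]z≡[xz]y; x∙yz≈y∙xz to x[yz]≡y[xz])
open import Data.Nat.Tactic.RingSolver using (solve-∀)
open import Data.Product using (_×_; _,_; proj₁; proj₂; Σ; map₂)
open import Data.Rational using (mkℚ)
import Data.Rational.Properties as Q
open import Data.Rational.Solver using (module +-*-Solver)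
open import Data.Rational.Unnormalised using (mkℚᵘ; *≡*)
import Data.Rational.Unnormalised.Properties as Qᵘ
open import Data.Sum using (inj₁; inj₂; [_,_]′)
open import Data.Vec using (Vec; toList; []; _∷_)
open import Data.Vec.Base using (here; there)
open import Function.Base using (_∘_; id)
open import Function.Bundles using (mk⇔; Equivalence)
open import Function.Construct.Composition using (_⇔-∘_)
open import Relation.Binary.Definitions using (tri<; tri≈; tri>)
open import Relation.Binary.PropositionalEquality using (_≡_; refl; sym; trans; cong; cong₂; subst; subst₂; module ≡-Reasoning)
open import Relation.Nullary using (yes; no; does; ¬_; contradiction)
open import Relation.Nullary.Decidable using (dec-true; dec-false; isYes; isYes≗does; does-⇔; _×-dec_)

ℕtoℚ≡mkℚ : ∀ n → ℕtoℚ n ≡ mkℚ (+ n) 0 (Coprime.sym (Coprime.1-coprimeTo n))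
ℕtoℚ≡mkℚ n = Q.normalize-coprime _

ℕtoℚ-+ : ∀ m n → ℕtoℚ (m + n) ≡ ℕtoℚ m Q.+ ℕtoℚ n
ℕtoℚ-+ m n rewrite ℕtoℚ≡mkℚ m | ℕtoℚ≡mkℚ n =
  Q./-cong (trans (ℤ.pos-+ m n) (sym (cong₂ ℤ._+_ (ℤ.*-identityʳ (+ m)) (ℤ.*-identityʳ (+ n))))) refl

ℕtoℚ-* : ∀ m n → ℕtoℚ (m * n) ≡ ℕtoℚ m Q.* ℕtoℚ n
ℕtoℚ-* m n rewrite ℕtoℚ≡mkℚ m | ℕtoℚ≡mkℚ n = Q./-cong (ℤ.pos-* m n) refl

ℕtoℚ-mono-≤ : ∀ {m n} → m ≤ n → ℕtoℚ m Q.≤ ℕtoℚ n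
ℕtoℚ-mono-≤ {m} {n} m≤n rewrite ℕtoℚ≡mkℚ m | ℕtoℚ≡mkℚ n =
  Q.*≤* (subst₂ ℤ._≤_ (sym (ℤ.*-identityʳ (+ m))) (sym (ℤ.*-identityʳ (+ n))) (ℤ.+≤+ m≤n))

ℕtoℚ-mono-< : ∀ {m n} → m < n → ℕtoℚ m Q.< ℕtoℚ n
ℕtoℚ-mono-< {m} {n} m<n rewrite ℕtoℚ≡mkℚ m | ℕtoℚ≡mkℚ n =
  Q.*<* (subst₂ ℤ._<_ (sym (ℤ.*-identityʳ (+ m))) (sym (ℤ.*-identityʳ (+ n))) (ℤ.+<+ m<n))

ℕtoℚ-cancel-< : ∀ {m n} → ℕtoℚ m Q.< ℕtoℚ n → m < n
ℕtoℚ-cancel-< {m} {n} lt rewrite ℕtoℚ≡mkℚ m | ℕtoℚ≡mkℚ n with lt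
... | Q.*<* p = ℤ.drop‿+<+ (subst₂ ℤ._<_ (ℤ.*-identityʳ (+ m)) (ℤ.*-identityʳ (+ n)) p)

mkℚ*den≡num : ∀ num den-1 .(cop : Coprime.Coprime num (suc den-1)) →
              mkℚ (+ num) den-1 cop Q.* ℕtoℚ (suc den-1) ≡ ℕtoℚ num
mkℚ*den≡num num den-1 cop rewrite ℕtoℚ≡mkℚ (suc den-1) =
  Q.fromℚᵘ-cong {mkℚᵘ (+ num ℤ.* + suc den-1) (den-1 * 1)} {mkℚᵘ (+ num) 0}
    (*≡* (trans (ℤ.*-identityʳ _) (cong (λ k → + num ℤ.* + suc k) (sym (*-identityʳ den-1)))))

mkℚ≤1⇒num≤den : ∀ num den-1 .(cop : Coprime.Coprime num (suc den-1)) →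
                mkℚ (+ num) den-1 cop Q.≤ Q.1ℚ → num ≤ suc den-1
mkℚ≤1⇒num≤den num den-1 cop (Q.*≤* le) =
  ℤ.drop‿+≤+ (subst₂ ℤ._≤_ (ℤ.*-identityʳ (+ num)) (ℤ.*-identityˡ (+ suc den-1)) le)

∣p-q∣≤r : ∀ p q r → p Q.≤ q Q.+ r → q Q.≤ p Q.+ r → Q.∣ p Q.- q ∣ Q.≤ r
∣p-q∣≤r p q r p≤q+r q≤p+r = [ nonneg , neg ]′ (Q.∣p∣≡p∨∣p∣≡-p (p Q.- q))
  where
  open +-*-Solver
  x+y-x≡y : ∀ x y → x Q.+ y Q.- x ≡ y
  x+y-x≡y = solve 2 (λ x y → x :+ y :- x := y) refl
  y-x≡-[x-y] : ∀ x y → y Q.- x ≡ Q.- (x Q.- y)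
  y-x≡-[x-y] = solve 2 (λ x y → y :- x := :- (x :- y)) refl
  nonneg : Q.∣ p Q.- q ∣ ≡ p Q.- q → Q.∣ p Q.- q ∣ Q.≤ r
  nonneg eq = subst (Q._≤ r) (sym eq) (subst₂ Q._≤_ refl (x+y-x≡y q r) (Q.+-monoˡ-≤ (Q.- q) p≤q+r))
  neg : Q.∣ p Q.- q ∣ ≡ Q.- (p Q.- q) → Q.∣ p Q.- q ∣ Q.≤ r
  neg eq = subst (Q._≤ r) (sym eq) (subst₂ Q._≤_ (y-x≡-[x-y] p q) (x+y-x≡y p r) (Q.+-monoˡ-≤ (Q.- p) q≤p+r))

module _ (c : ℚ) (num den : ℕ) .{{_ : NonZero den}} (c*den≡num : c Q.* ℕtoℚ den ≡ ℕtoℚ num) where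

  private
    D = ℕtoℚ den

    instance
      D-pos : Q.Positive D
      D-pos = Q.positive (ℕtoℚ-mono-< (ℕ.>-nonZero⁻¹ den))

    c*n*D≡num*n : ∀ n → (c Q.* ℕtoℚ n) Q.* D ≡ ℕtoℚ (num * n)
    c*n*D≡num*n n = begin
      (c Q.* ℕtoℚ n) Q.* D  ≡⟨ solve 3 (λ c n D → (c :* n) :* D := (c :* D) :* n) refl c (ℕtoℚ n) D ⟩
      (c Q.* D) Q.* ℕtoℚ n  ≡⟨ cong (Q._* ℕtoℚ n) c*den≡num ⟩
      ℕtoℚ num Q.* ℕtoℚ n   ≡⟨ ℕtoℚ-* num n ⟨
      ℕtoℚ (num * n)        ∎
      where open ≡-Reasoning
            open +-*-Solver

    n*c*D≡num*n : ∀ n → (ℕtoℚ n Q.* c) Q.* D ≡ ℕtoℚ (num * n)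
    n*c*D≡num*n n = trans (cong (Q._* D) (Q.*-comm (ℕtoℚ n) c)) (c*n*D≡num*n n)

  ℕtoℚ<c*ℕtoℚ⇔ : ∀ x y → (ℕtoℚ x Q.< c Q.* ℕtoℚ y) ⇔ (x * den < num * y)
  ℕtoℚ<c*ℕtoℚ⇔ x y = mk⇔
    (λ lt → ℕtoℚ-cancel-< (subst₂ Q._<_ (sym (ℕtoℚ-* x den)) (c*n*D≡num*n y) (Q.*-monoˡ-<-pos D lt)))
    (λ lt → Q.*-cancelʳ-<-nonNeg D {{Q.pos⇒nonNeg D}}
              (subst₂ Q._<_ (ℕtoℚ-* x den) (sym (c*n*D≡num*n y)) (ℕtoℚ-mono-< lt)))

  ∣a-n*c∣≤e : ∀ a n e → a * den ≤ num * n + e * den → num * n ≤ (a + e) * den →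
              Q.∣ ℕtoℚ a Q.- ℕtoℚ n Q.* c ∣ Q.≤ ℕtoℚ e
  ∣a-n*c∣≤e a n e upper lower = ∣p-q∣≤r (ℕtoℚ a) (ℕtoℚ n Q.* c) (ℕtoℚ e)
    (Q.*-cancelʳ-≤-pos D (subst₂ Q._≤_ (ℕtoℚ-* a den) upper-scaled (ℕtoℚ-mono-≤ upper)))
    (Q.*-cancelʳ-≤-pos D (subst₂ Q._≤_ (sym (n*c*D≡num*n n)) lower-scaled (ℕtoℚ-mono-≤ lower)))
    where
    open ≡-Reasoning
    upper-scaled : ℕtoℚ (num * n + e * den) ≡ (ℕtoℚ n Q.* c Q.+ ℕtoℚ e) Q.* D
    upper-scaled = begin
      ℕtoℚ (num * n + e * den)                  ≡⟨ ℕtoℚ-+ (num * n) (e * den) ⟩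
      ℕtoℚ (num * n) Q.+ ℕtoℚ (e * den)         ≡⟨ cong₂ Q._+_ (sym (n*c*D≡num*n n)) (ℕtoℚ-* e den) ⟩
      (ℕtoℚ n Q.* c) Q.* D Q.+ ℕtoℚ e Q.* D     ≡⟨ Q.*-distribʳ-+ D (ℕtoℚ n Q.* c) (ℕtoℚ e) ⟨
      (ℕtoℚ n Q.* c Q.+ ℕtoℚ e) Q.* D           ∎
    lower-scaled : ℕtoℚ ((a + e) * den) ≡ (ℕtoℚ a Q.+ ℕtoℚ e) Q.* D
    lower-scaled = trans (ℕtoℚ-* (a + e) den) (cong (Q._* D) (ℕtoℚ-+ a e))

2*m≤2*n+k⇒m≤n+k/2 : ∀ m n k → 2 * m ≤ 2 * n + k → ℕtoℚ m Q.≤ ℕtoℚ n Q.+ (+ k) Q./ 2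
2*m≤2*n+k⇒m≤n+k/2 m n k le = Q.*-cancelʳ-≤-pos (ℕtoℚ 2) (subst₂ Q._≤_ lhs rhs (ℕtoℚ-mono-≤ le))
  where
  open ≡-Reasoning
  open +-*-Solver
  lhs : ℕtoℚ (2 * m) ≡ ℕtoℚ m Q.* ℕtoℚ 2
  lhs = trans (ℕtoℚ-* 2 m) (Q.*-comm (ℕtoℚ 2) (ℕtoℚ m))
  k/2*2≡k : (+ k) Q./ 2 Q.* ℕtoℚ 2 ≡ ℕtoℚ k
  k/2*2≡k = Q.toℚᵘ-injective (Qᵘ.≃-trans (Q.toℚᵘ-homo-* ((+ k) Q./ 2) (ℕtoℚ 2))
    (Qᵘ.≃-trans (Qᵘ.*-cong (Q.toℚᵘ-fromℚᵘ (mkℚᵘ (+ k) 1)) (Q.toℚᵘ-fromℚᵘ (mkℚᵘ (+ 2) 0)))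
    (Qᵘ.≃-trans (*≡* (ℤ.*-identityʳ _)) (Qᵘ.≃-sym (Q.toℚᵘ-fromℚᵘ (mkℚᵘ (+ k) 0))))))
  rhs : ℕtoℚ (2 * n + k) ≡ (ℕtoℚ n Q.+ (+ k) Q./ 2) Q.* ℕtoℚ 2
  rhs = begin
    ℕtoℚ (2 * n + k)                                  ≡⟨ ℕtoℚ-+ (2 * n) k ⟩
    ℕtoℚ (2 * n) Q.+ ℕtoℚ k                           ≡⟨ cong₂ Q._+_ (ℕtoℚ-* 2 n) (sym k/2*2≡k) ⟩
    ℕtoℚ 2 Q.* ℕtoℚ n Q.+ (+ k) Q./ 2 Q.* ℕtoℚ 2     ≡⟨ solve 3 (λ n h t → t :* n :+ h :* t := (n :+ h) :* t) refl
                                                           (ℕtoℚ n) ((+ k) Q./ 2) (ℕtoℚ 2) ⟩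
    (ℕtoℚ n Q.+ (+ k) Q./ 2) Q.* ℕtoℚ 2               ∎

∑< : ℕ → (ℕ → ℕ) → ℕ
∑< zero    h = 0
∑< (suc L) h = ∑< L h + h L

syntax ∑< L (λ p → e) = ∑[ p < L ] e

module _ {h h′ : ℕ → ℕ} where

  ∑-cong : ∀ L → (∀ p → p < L → h p ≡ h′ p) → ∑[ p < L ] h p ≡ ∑[ p < L ] h′ p
  ∑-cong zero    eq = refl
  ∑-cong (suc L) eq = cong₂ _+_ (∑-cong L (λ p p<L → eq p (m<n⇒m<1+n p<L))) (eq L ≤-refl)

  ∑-mono-≤ : ∀ L → (∀ p → p < L → h p ≤ h′ p) → ∑[ p < L ] h p ≤ ∑[ p < L ] h′ p
  ∑-mono-≤ zero    le = z≤n
  ∑-mono-≤ (suc L) le = +-mono-≤ (∑-mono-≤ L (λ p p<L → le p (m<n⇒m<1+n p<L))) (le L ≤-refl)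

  ∑-distrib-+ : ∀ L → ∑[ p < L ] (h p + h′ p) ≡ ∑[ p < L ] h p + ∑[ p < L ] h′ p
  ∑-distrib-+ zero    = refl
  ∑-distrib-+ (suc L) rewrite ∑-distrib-+ L = +-interchange (∑< L h) (∑< L h′) (h L) (h′ L)

∑-split : ∀ (h : ℕ → ℕ) K M → ∑[ p < K + M ] h p ≡ ∑[ p < K ] h p + ∑[ p < M ] h (K + p)
∑-split h K zero    = trans (cong (λ L → ∑< L h) (+-identityʳ K)) (sym (+-identityʳ _))
∑-split h K (suc M) = begin
  ∑[ p < K + suc M ] h p                                   ≡⟨ cong (λ L → ∑< L h) (+-suc K M) ⟩
  ∑[ p < K + M ] h p + h (K + M)                           ≡⟨ cong (_+ h (K + M)) (∑-split h K M) ⟩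
  ∑[ p < K ] h p + ∑[ p < M ] h (K + p) + h (K + M)        ≡⟨ +-assoc (∑< K h) _ _ ⟩
  ∑[ p < K ] h p + ∑[ p < suc M ] h (K + p)                ∎
  where open ≡-Reasoning

∑-const : ∀ L k → ∑[ p < L ] k ≡ L * k
∑-const zero    k = refl
∑-const (suc L) k rewrite ∑-const L k = +-comm (L * k) k

∑-≤-const : ∀ (h : ℕ → ℕ) L k → (∀ p → p < L → h p ≤ k) → ∑[ p < L ] h p ≤ L * k
∑-≤-const h L k le = subst (∑< L h ≤_) (∑-const L k) (∑-mono-≤ L le)

∑-≤-length : ∀ (h : ℕ → ℕ) L → (∀ p → h p ≤ 1) → ∑[ p < L ] h p ≤ L
∑-≤-length h L h≤1 = subst (∑< L h ≤_) (*-identityʳ L) (∑-≤-const h L 1 (λ p _ → h≤1 p))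

∑-≤-∑-agreeing : ∀ (h h′ : ℕ → ℕ) L i → (∀ p → h p ≤ 1) → (∀ p → p + i ≤ L → h p ≡ h′ p) →
                 ∑[ p < L ] h p ≤ ∑[ p < L ] h′ p + i
∑-≤-∑-agreeing h h′ L i h≤1 agree with i ≤? L
... | no i≰L = ≤-trans (∑-≤-length h L h≤1) (≤-trans (<⇒≤ (≰⇒> i≰L)) (m≤n+m i _))
... | yes i≤L = subst (λ L → ∑< L h ≤ ∑< L h′ + i) (m∸n+n≡m i≤L) (begin
  ∑[ p < K + i ] h p                                 ≡⟨ ∑-split h K i ⟩
  ∑[ p < K ] h p + ∑[ p < i ] h (K + p)              ≤⟨ +-mono-≤ (≤-reflexive (∑-cong K agree′)) (∑-≤-length _ i (λ p → h≤1 (K + p))) ⟩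
  ∑[ p < K ] h′ p + i                                ≤⟨ +-monoˡ-≤ i (m≤m+n (∑< K h′) _) ⟩
  ∑[ p < K ] h′ p + ∑[ p < i ] h′ (K + p) + i        ≡⟨ cong (_+ i) (∑-split h′ K i) ⟨
  ∑[ p < K + i ] h′ p + i                            ∎)
  where
  open ≤-Reasoning
  K = L ∸ i
  agree′ : ∀ p → p < K → h p ≡ h′ p
  agree′ p p<K = agree p (subst (p + i ≤_) (m∸n+n≡m i≤L) (+-monoˡ-≤ i (<⇒≤ p<K)))

𝟙 : Bool → ℕ
𝟙 true  = 1
𝟙 false = 0

𝟙≤1 : ∀ x → 𝟙 x ≤ 1
𝟙≤1 true  = ≤-refl
𝟙≤1 false = z≤n

𝟙[_<_] : ℕ → ℕ → ℕ
𝟙[ x < y ] = 𝟙 (does (x <? y))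

𝟙[_≡_] : ℕ → ℕ → ℕ
𝟙[ x ≡ y ] = 𝟙 (does (x ≟ y))

𝟙[<suc] : ∀ x y → 𝟙[ x < suc y ] ≡ 𝟙[ x < y ] + 𝟙[ x ≡ y ]
𝟙[<suc] x y with <-cmp x y
... | tri< x<y x≢y _
  rewrite dec-true (x <? suc y) (m<n⇒m<1+n x<y) | dec-true (x <? y) x<y | dec-false (x ≟ y) x≢y = refl
... | tri≈ x≮y refl _
  rewrite dec-true (x <? suc x) (n<1+n x) | dec-false (x <? x) x≮y | dec-true (x ≟ x) refl = refl
... | tri> x≮y x≢y y<x
  rewrite dec-false (x <? suc y) (λ x<1+y → <⇒≱ y<x (s≤s⁻¹ x<1+y)) | dec-false (x <? y) x≮y
        | dec-false (x ≟ y) x≢y = refl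

∑𝟙[<]≡∑∑𝟙[≡] : ∀ (h : ℕ → ℕ) L Q → ∑[ p < L ] 𝟙[ h p < Q ] ≡ ∑[ v < Q ] ∑[ p < L ] 𝟙[ h p ≡ v ]
∑𝟙[<]≡∑∑𝟙[≡] h L zero    = trans (∑-const L 0) (*-zeroʳ L)
∑𝟙[<]≡∑∑𝟙[≡] h L (suc Q) = begin
  ∑[ p < L ] 𝟙[ h p < suc Q ]                               ≡⟨ ∑-cong L (λ p _ → 𝟙[<suc] (h p) Q) ⟩
  ∑[ p < L ] (𝟙[ h p < Q ] + 𝟙[ h p ≡ Q ])                  ≡⟨ ∑-distrib-+ L ⟩
  ∑[ p < L ] 𝟙[ h p < Q ] + ∑[ p < L ] 𝟙[ h p ≡ Q ]         ≡⟨ cong (_+ ∑[ p < L ] 𝟙[ h p ≡ Q ]) (∑𝟙[<]≡∑∑𝟙[≡] h L Q) ⟩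
  ∑[ v < suc Q ] ∑[ p < L ] 𝟙[ h p ≡ v ]                    ∎
  where open ≡-Reasoning

countTrue≡∑𝟙 : ∀ P L → countTrue P L ≡ ∑[ p < L ] 𝟙 (P p)
countTrue≡∑𝟙 P zero = refl
countTrue≡∑𝟙 P (suc L) with P L
... | true  = trans (cong suc (countTrue≡∑𝟙 P L)) (+-comm 1 _)
... | false = trans (countTrue≡∑𝟙 P L) (sym (+-identityʳ _))

𝟙∈ : ∀ {N} → Subset N → ℕ → ℕ
𝟙∈ []      _       = 0
𝟙∈ (x ∷ A) zero    = 𝟙 x
𝟙∈ (x ∷ A) (suc n) = 𝟙∈ A n

𝟙∈≤1 : ∀ {N} (A : Subset N) n → 𝟙∈ A n ≤ 1
𝟙∈≤1 []      n       = z≤n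
𝟙∈≤1 (x ∷ A) zero    = 𝟙≤1 x
𝟙∈≤1 (x ∷ A) (suc n) = 𝟙∈≤1 A n

𝟙∈-∈ : ∀ {N} (A : Subset N) (i : Fin N) → i ∈ A → 𝟙∈ A (toℕ i) ≡ 1
𝟙∈-∈ (x ∷ A) Fin.zero    here      = refl
𝟙∈-∈ (x ∷ A) (Fin.suc i) (there p) = 𝟙∈-∈ A i p

𝟙∈-∉ : ∀ {N} (A : Subset N) (i : Fin N) → ¬ i ∈ A → 𝟙∈ A (toℕ i) ≡ 0
𝟙∈-∉ (inside  ∷ A) Fin.zero    i∉A = contradiction here i∉A
𝟙∈-∉ (outside ∷ A) Fin.zero    i∉A = refl
𝟙∈-∉ (x ∷ A)       (Fin.suc i) i∉A = 𝟙∈-∉ A i (i∉A ∘ there)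

∣A∣≡∑𝟙∈ : ∀ {N} (A : Subset N) → ∣ A ∣ ≡ ∑[ n < N ] 𝟙∈ A n
∣A∣≡∑𝟙∈ []                  = refl
∣A∣≡∑𝟙∈ {suc N} (inside ∷ A)  = trans (cong suc (∣A∣≡∑𝟙∈ A)) (sym (∑-split (𝟙∈ (inside ∷ A)) 1 N))
∣A∣≡∑𝟙∈ {suc N} (outside ∷ A) = trans (∣A∣≡∑𝟙∈ A) (sym (∑-split (𝟙∈ (outside ∷ A)) 1 N))

-- Base-b digit strings

m*o+n<p*o : ∀ {m n o p} → m < p → n < o → m * o + n < p * o
m*o+n<p*o {m} {n} {o} {p} m<p n<o = begin-strict
  m * o + n   <⟨ +-monoʳ-< (m * o) n<o ⟩
  m * o + o   ≡⟨ +-comm (m * o) o ⟩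
  suc m * o   ≤⟨ *-monoˡ-≤ o m<p ⟩
  p * o       ∎
  where open ≤-Reasoning

m*o+n-injective : ∀ {m n o p q} → n < o → q < o → m * o + n ≡ p * o + q → m ≡ p × n ≡ q
m*o+n-injective {m} {n} {o} {p} {q} n<o q<o eq = m≡p , n≡q
  where
  instance
    o≢0 : NonZero o
    o≢0 = ℕ.>-nonZero (≤-<-trans z≤n n<o)
  open ≡-Reasoning
  n≡q : n ≡ q
  n≡q = begin
    n                ≡⟨ m<n⇒m%n≡m n<o ⟨
    n % o            ≡⟨ [m+kn]%n≡m%n n m o ⟨
    (n + m * o) % o  ≡⟨ cong (_% o) (trans (+-comm n (m * o)) (trans eq (+-comm (p * o) q))) ⟩
    (q + p * o) % o  ≡⟨ [m+kn]%n≡m%n q p o ⟩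
    q % o            ≡⟨ m<n⇒m%n≡m q<o ⟩
    q                ∎
  m≡p : m ≡ p
  m≡p = *-cancelʳ-≡ m p o (+-cancelʳ-≡ n (m * o) (p * o) (trans eq (cong (λ x → p * o + x) (sym n≡q))))

module _ {b : ℕ} where

  trunc-+ : ∀ (d : ℕ → Fin b) n i r → trunc d n (i + r) ≡ trunc d n i * b ^ r + trunc d (n + i) r
  trunc-+ d n i zero    = trans (cong (trunc d n) (+-identityʳ i)) (sym (trans (+-identityʳ _) (*-identityʳ _)))
  trunc-+ d n i (suc r) = begin
    trunc d n (i + suc r)                                          ≡⟨ cong (trunc d n) (+-suc i r) ⟩
    trunc d n (i + r) * b + toℕ (d (n + (i + r)))                  ≡⟨ cong₂ (λ t j → t * b + toℕ (d j)) (trunc-+ d n i r) (sym (+-assoc n i r)) ⟩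
    (trunc d n i * b ^ r + trunc d (n + i) r) * b + toℕ (d (n + i + r))
      ≡⟨ cong (_+ toℕ (d (n + i + r))) (shift (trunc d n i) (b ^ r) (trunc d (n + i) r) b) ⟩
    trunc d n i * (b * b ^ r) + trunc d (n + i) r * b + toℕ (d (n + i + r))
      ≡⟨ +-assoc (trunc d n i * (b * b ^ r)) _ _ ⟩
    trunc d n i * b ^ suc r + trunc d (n + i) (suc r)              ∎
    where
    open ≡-Reasoning
    shift : ∀ t B t′ b → (t * B + t′) * b ≡ t * (b * B) + t′ * b
    shift = solve-∀

  trunc<b^ : ∀ (d : ℕ → Fin b) n k → trunc d n k < b ^ k
  trunc<b^ d n zero    = s≤s z≤n
  trunc<b^ d n (suc k) =
    subst (trunc d n (suc k) <_) (*-comm (b ^ k) b) (m*o+n<p*o (trunc<b^ d n k) (Fin.toℕ<n (d (n + k))))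

  trunc-suc : ∀ (d : ℕ → Fin b) n k → trunc d n (suc k) ≡ toℕ (d n) * b ^ k + trunc d (suc n) k
  trunc-suc d n k = trans (trunc-+ d n 1 k)
    (cong₂ (λ m n′ → toℕ (d m) * b ^ k + trunc d n′ k) (+-identityʳ n) (+-comm n 1))

  trunc-cong : ∀ (d d′ : ℕ → Fin b) n n′ k → (∀ r → r < k → d (n + r) ≡ d′ (n′ + r)) →
               trunc d n k ≡ trunc d′ n′ k
  trunc-cong d d′ n n′ zero    eq = refl
  trunc-cong d d′ n n′ (suc k) eq =
    cong₂ (λ t x → t * b + toℕ x) (trunc-cong d d′ n n′ k (λ r r<k → eq r (m<n⇒m<1+n r<k))) (eq k ≤-refl)

  -- Both sides bound the point: Tᵢ/bⁱ ≤ {bⁿα} ≤ (Tₖ + 1)/bᵏ.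
  trunc-cross : ∀ (d : ℕ → Fin b) n i k → trunc d n i * b ^ k ≤ suc (trunc d n k) * b ^ i
  trunc-cross d n i k with ≤-total k i
  ... | inj₁ k≤i = begin
    trunc d n i * b ^ k                                 ≡⟨ cong (λ j → trunc d n j * b ^ k) (m+[n∸m]≡n k≤i) ⟨
    trunc d n (k + r) * b ^ k                           ≡⟨ cong (_* b ^ k) (trunc-+ d n k r) ⟩
    (trunc d n k * b ^ r + trunc d (n + k) r) * b ^ k   ≤⟨ *-monoˡ-≤ (b ^ k) (+-monoʳ-≤ (trunc d n k * b ^ r) (<⇒≤ (trunc<b^ d (n + k) r))) ⟩
    (trunc d n k * b ^ r + b ^ r) * b ^ k               ≡⟨ regroup (trunc d n k) (b ^ r) (b ^ k) ⟩
    suc (trunc d n k) * (b ^ k * b ^ r)                 ≡⟨ cong (suc (trunc d n k) *_) (^-distribˡ-+-* b k r) ⟨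
    suc (trunc d n k) * b ^ (k + r)                     ≡⟨ cong (λ j → suc (trunc d n k) * b ^ j) (m+[n∸m]≡n k≤i) ⟩
    suc (trunc d n k) * b ^ i                           ∎
    where
    open ≤-Reasoning
    r = i ∸ k
    regroup : ∀ t B C → (t * B + B) * C ≡ suc t * (C * B)
    regroup = solve-∀
  ... | inj₂ i≤k = begin
    trunc d n i * b ^ k                                 ≡⟨ cong (λ j → trunc d n i * b ^ j) (m+[n∸m]≡n i≤k) ⟨
    trunc d n i * b ^ (i + r)                           ≡⟨ cong (trunc d n i *_) (^-distribˡ-+-* b i r) ⟩
    trunc d n i * (b ^ i * b ^ r)                       ≡⟨ regroup (trunc d n i) (b ^ i) (b ^ r) ⟩
    trunc d n i * b ^ r * b ^ i                         ≤⟨ *-monoˡ-≤ (b ^ i) (m≤m+n (trunc d n i * b ^ r) (trunc d (n + i) r)) ⟩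
    (trunc d n i * b ^ r + trunc d (n + i) r) * b ^ i   ≡⟨ cong (_* b ^ i) (trunc-+ d n i r) ⟨
    trunc d n (i + r) * b ^ i                           ≡⟨ cong (λ j → trunc d n j * b ^ i) (m+[n∸m]≡n i≤k) ⟩
    trunc d n k * b ^ i                                 ≤⟨ *-monoˡ-≤ (b ^ i) (n≤1+n (trunc d n k)) ⟩
    suc (trunc d n k) * b ^ i                           ∎
    where
    open ≤-Reasoning
    r = k ∸ i
    regroup : ∀ t B C → t * (B * C) ≡ t * C * B
    regroup = solve-∀

  trunc-room : ∀ (d : ℕ → Fin b) n i r → 2 + toℕ (d (n + i + r)) ≤ b →
               2 + trunc d n (i + suc r) ≤ suc (trunc d n i) * b ^ suc r
  trunc-room d n i r digit<b-1 = begin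
    2 + trunc d n (i + suc r)                   ≡⟨ cong (λ y → 2 + y) (trunc-+ d n i (suc r)) ⟩
    2 + (t * B + (t′ * b + x))                  ≡⟨ regroup (t * B) (t′ * b) x ⟩
    t * B + t′ * b + (2 + x)                    ≤⟨ +-monoʳ-≤ (t * B + t′ * b) digit<b-1 ⟩
    t * B + t′ * b + b                          ≡⟨ +-assoc (t * B) (t′ * b) b ⟩
    t * B + (t′ * b + b)                        ≡⟨ cong (λ y → t * B + y) (+-comm (t′ * b) b) ⟩
    t * B + suc t′ * b                          ≤⟨ +-monoʳ-≤ (t * B) (*-monoˡ-≤ b (trunc<b^ d (n + i) r)) ⟩
    t * B + b ^ r * b                           ≡⟨ cong (λ y → t * B + y) (*-comm (b ^ r) b) ⟩
    t * B + B                                   ≡⟨ +-comm (t * B) B ⟩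
    suc t * B                                   ∎
    where
    open ≤-Reasoning
    t  = trunc d n i
    t′ = trunc d (n + i) r
    x  = toℕ (d (n + i + r))
    B  = b ^ suc r
    regroup : ∀ y z x → 2 + (y + (z + x)) ≡ y + z + (2 + x)
    regroup = solve-∀

  value : ∀ {k} → Vec (Fin b) k → ℕ
  value []              = 0
  value {suc k} (x ∷ u) = toℕ x * b ^ k + value u

  value<b^ : ∀ {k} (u : Vec (Fin b) k) → value u < b ^ k
  value<b^ []      = s≤s z≤n
  value<b^ (x ∷ u) = m*o+n<p*o (Fin.toℕ<n x) (value<b^ u)

  value-surjective : .{{_ : NonZero b}} → ∀ k v → v < b ^ k → Σ (Vec (Fin b) k) (λ u → value u ≡ v)
  value-surjective zero    zero    _          = [] , refl
  value-surjective zero    (suc v) (s≤s ())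
  value-surjective (suc k) v       v<b^[1+k] = fromℕ< q<b ∷ u , value≡v
    where
    instance
      b^k≢0 : NonZero (b ^ k)
      b^k≢0 = m^n≢0 b k
    q<b : v / b ^ k < b
    q<b = m<n*o⇒m/o<n v<b^[1+k]
    rest = value-surjective k (v % b ^ k) (m%n<n v (b ^ k))
    u = proj₁ rest
    open ≡-Reasoning
    value≡v : toℕ (fromℕ< q<b) * b ^ k + value u ≡ v
    value≡v = begin
      toℕ (fromℕ< q<b) * b ^ k + value u   ≡⟨ cong₂ (λ q r → q * b ^ k + r) (Fin.toℕ-fromℕ< q<b) (proj₂ rest) ⟩
      v / b ^ k * b ^ k + v % b ^ k        ≡⟨ +-comm (v / b ^ k * b ^ k) _ ⟩
      v % b ^ k + v / b ^ k * b ^ k        ≡⟨ m≡m%n+[m/n]*n v (b ^ k) ⟨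
      v                                    ∎

  trunc≡value⇔ : ∀ (d : ℕ → Fin b) p {k} x (u : Vec (Fin b) k) →
                 (d p ≡ x × trunc d (suc p) k ≡ value u) ⇔ (trunc d p (suc k) ≡ value (x ∷ u))
  trunc≡value⇔ d p {k} x u = mk⇔
    (λ { (refl , eq) → trans (trunc-suc d p k) (cong (λ r → toℕ (d p) * b ^ k + r) eq) })
    (λ eq → let digit≡ , rest≡ = m*o+n-injective (trunc<b^ d (suc p) k) (value<b^ u) (trans (sym (trunc-suc d p k)) eq)
            in Fin.toℕ-injective digit≡ , rest≡)

  matchFrom≡does : ∀ (w : List (Fin b)) (d : ℕ → Fin b) → (∀ q → circularAt w q ≡ just (d q)) →
                   ∀ {k} (u : Vec (Fin b) k) p → matchFrom w (toList u) p ≡ does (trunc d p k ≟ value u)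
  matchFrom≡does w d w≡d []            p = refl
  matchFrom≡does w d w≡d {suc k} (x ∷ u) p = begin
    eqM (circularAt w p) x ∧ matchFrom w (toList u) (suc p)
      ≡⟨ cong₂ _∧_ (cong (λ y → eqM y x) (w≡d p)) (matchFrom≡does w d w≡d u (suc p)) ⟩
    isYes (d p Fin.≟ x) ∧ does (trunc d (suc p) k ≟ value u)
      ≡⟨ cong (_∧ does (trunc d (suc p) k ≟ value u)) (isYes≗does (d p Fin.≟ x)) ⟩
    does (d p Fin.≟ x ×-dec trunc d (suc p) k ≟ value u)
      ≡⟨ does-⇔ (trunc≡value⇔ d p x u) (d p Fin.≟ x ×-dec trunc d (suc p) k ≟ value u)
                                        (trunc d p (suc k) ≟ value (x ∷ u)) ⟩
    does (trunc d p (suc k) ≟ value (x ∷ u))    ∎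
    where open ≡-Reasoning

-- Necklaces

Reads : ∀ {b} → List (Fin b) → (ℕ → Fin b) → Set
Reads w e = ∀ q → q < length w → w !! q ≡ just (e q)

module _ {b : ℕ} where

  map-applyUpTo-reads : ∀ (h : ℕ → Fin b) f L → Reads (map h (applyUpTo f L)) (h ∘ f)
  map-applyUpTo-reads h f (suc L) zero    _         = refl
  map-applyUpTo-reads h f (suc L) (suc q) (s≤s q<L) = map-applyUpTo-reads h (f ∘ suc) L q q<L

  slice-reads : ∀ (d : ℕ → Fin b) s L → Reads (slice d s L) (λ q → d (s + q))
  slice-reads d s L = map-applyUpTo-reads (λ q → d (s + q)) id L

  tail-reads : ∀ {x : Fin b} {w e} → Reads (x List.∷ w) e → Reads w (e ∘ suc)
  tail-reads reads q q<∣w∣ = reads (suc q) (s≤s q<∣w∣)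

  take-reads : ∀ a {w e} → Reads w e → Reads (take a w) e
  take-reads (suc a) {x List.∷ w} reads zero    _           = reads zero (s≤s z≤n)
  take-reads (suc a) {x List.∷ w} reads (suc q) (s≤s q<∣w∣) = take-reads a (tail-reads reads) q q<∣w∣

  drop-reads : ∀ o {w e} → Reads w e → Reads (drop o w) (λ q → e (o + q))
  drop-reads zero              reads = reads
  drop-reads (suc o) {List.[]} reads q ()
  drop-reads (suc o) {x List.∷ w} reads = drop-reads o (tail-reads reads)

modℕ≡% : ∀ q L .{{_ : NonZero L}} → modℕ q L ≡ q % L
modℕ≡% q (suc L) = refl

module Necklace {b : ℕ} .{{_ : NonZero b}} {i g : ℕ} {w : List (Fin b)} {e : ℕ → Fin b}
                (semiPerfect : SemiPerfect b i g w) (reads : Reads w e)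
                .{{_ : NonZero (g * b ^ i)}} where

  L = g * b ^ i

  private
    ∣w∣≡L : length w ≡ L
    ∣w∣≡L = proj₁ semiPerfect

  ẽ : ℕ → Fin b
  ẽ q = e (q % L)

  circularAt≡ẽ : ∀ q → circularAt w q ≡ just (ẽ q)
  circularAt≡ẽ q = begin
    w !! modℕ q (length w)   ≡⟨ cong (λ n → w !! modℕ q n) ∣w∣≡L ⟩
    w !! modℕ q L            ≡⟨ cong (w !!_) (modℕ≡% q L) ⟩
    w !! (q % L)             ≡⟨ reads (q % L) (subst (q % L <_) (sym ∣w∣≡L) (m%n<n q L)) ⟩
    just (ẽ q)               ∎
    where open ≡-Reasoning

  count-value : ∀ v → v < b ^ i → ∑[ p < L ] 𝟙[ trunc ẽ p i ≡ v ] ≡ g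
  count-value v v<b^i with value-surjective i v v<b^i
  ... | u , refl = begin
    ∑[ p < L ] 𝟙[ trunc ẽ p i ≡ value u ]        ≡⟨ ∑-cong L (λ p _ → cong 𝟙 (matchFrom≡does w ẽ circularAt≡ẽ u p)) ⟨
    ∑[ p < L ] 𝟙 (matchFrom w (toList u) p)      ≡⟨ countTrue≡∑𝟙 (matchFrom w (toList u)) L ⟨
    countTrue (matchFrom w (toList u)) L         ≡⟨ cong (countTrue (matchFrom w (toList u))) ∣w∣≡L ⟨
    occurrences w (toList u)                     ≡⟨ proj₂ semiPerfect u ⟩
    g                                            ∎
    where open ≡-Reasoning

  count-value≤ : ∀ v → ∑[ p < L ] 𝟙[ trunc ẽ p i ≡ v ] ≤ g
  count-value≤ v with v <? b ^ i
  ... | yes v<b^i = ≤-reflexive (count-value v v<b^i)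
  ... | no  v≮b^i = ≤-trans (≤-reflexive (trans (∑-cong L none) (trans (∑-const L 0) (*-zeroʳ L)))) z≤n
    where
    none : ∀ p → p < L → 𝟙[ trunc ẽ p i ≡ v ] ≡ 0
    none p _ rewrite dec-false (trunc ẽ p i ≟ v) (λ { refl → v≮b^i (trunc<b^ ẽ p i) }) = refl

  count-below : ∀ Q → Q ≤ b ^ i → ∑[ p < L ] 𝟙[ trunc ẽ p i < Q ] ≡ Q * g
  count-below Q Q≤b^i = begin
    ∑[ p < L ] 𝟙[ trunc ẽ p i < Q ]              ≡⟨ ∑𝟙[<]≡∑∑𝟙[≡] (λ p → trunc ẽ p i) L Q ⟩
    ∑[ v < Q ] ∑[ p < L ] 𝟙[ trunc ẽ p i ≡ v ]   ≡⟨ ∑-cong Q (λ v v<Q → count-value v (<-≤-trans v<Q Q≤b^i)) ⟩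
    ∑[ v < Q ] g                                 ≡⟨ ∑-const Q g ⟩
    Q * g                                        ∎
    where open ≡-Reasoning

  count-below≤ : ∀ Q → ∑[ p < L ] 𝟙[ trunc ẽ p i < Q ] ≤ Q * g
  count-below≤ Q = subst (_≤ Q * g) (sym (∑𝟙[<]≡∑∑𝟙[≡] (λ p → trunc ẽ p i) L Q))
                         (∑-≤-const _ Q g (λ v _ → count-value≤ v))

  trunc-ẽ : ∀ p → p + i ≤ L → trunc ẽ p i ≡ trunc e p i
  trunc-ẽ p p+i≤L = trunc-cong ẽ e p p i (λ r r<i → cong e (m<n⇒m%n≡m (<-≤-trans (+-monoʳ-< p r<i) p+i≤L)))

  private
    agree : ∀ Q p → p + i ≤ L → 𝟙[ trunc ẽ p i < Q ] ≡ 𝟙[ trunc e p i < Q ]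
    agree Q p p+i≤L = cong (λ t → 𝟙[ t < Q ]) (trunc-ẽ p p+i≤L)

  count-below-lower : ∀ P → P ≤ b ^ i → P * g ≤ ∑[ p < L ] 𝟙[ trunc e p i < P ] + i
  count-below-lower P P≤b^i = subst (_≤ ∑[ p < L ] 𝟙[ trunc e p i < P ] + i) (count-below P P≤b^i)
    (∑-≤-∑-agreeing _ _ L i (λ p → 𝟙≤1 _) (agree P))

  count-below-upper : ∀ Q → ∑[ p < L ] 𝟙[ trunc e p i < Q ] ≤ Q * g + i
  count-below-upper Q = ≤-trans (∑-≤-∑-agreeing _ _ L i (λ p → 𝟙≤1 _) (λ p le → sym (agree Q p le)))
                                (+-monoˡ-≤ i (count-below≤ Q))

-- Location of the points {bⁿα}

-- {bⁿα} < num/den, witnessed by a truncation: (Tₖ + 1)/bᵏ < num/den.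
Below : ∀ {b} → (ℕ → Fin b) → ℕ → ℕ → ℕ → Set
Below {b} d n num den = ∃ λ k → suc (trunc d n k) * den < num * b ^ k

PointBelow⇔Below : ∀ {b} (d : ℕ → Fin b) (c : ℚ) (num den : ℕ) .{{_ : NonZero den}} →
                   c Q.* ℕtoℚ den ≡ ℕtoℚ num → ∀ n → PointBelow d n c ⇔ Below d n num den
PointBelow⇔Below {b} d c num den c*den≡num n = mk⇔
  (map₂ λ {k} → Equivalence.to   (ℕtoℚ<c*ℕtoℚ⇔ c num den c*den≡num (suc (trunc d n k)) (b ^ k)))
  (map₂ λ {k} → Equivalence.from (ℕtoℚ<c*ℕtoℚ⇔ c num den c*den≡num (suc (trunc d n k)) (b ^ k)))

module PointLocation {b : ℕ} .{{_ : NonZero b}} (d : ℕ → Fin b) (num den : ℕ) .{{_ : NonZero den}} where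

  ⌊num*b^_/den⌋ : ℕ → ℕ
  ⌊num*b^ i /den⌋ = num * b ^ i / den

  ⌊⌋*den≤ : ∀ i → ⌊num*b^ i /den⌋ * den ≤ num * b ^ i
  ⌊⌋*den≤ i = m/n*n≤m (num * b ^ i) den

  <[1+⌊⌋]*den : ∀ i → num * b ^ i < suc ⌊num*b^ i /den⌋ * den
  <[1+⌊⌋]*den i = begin-strict
    num * b ^ i                                  ≡⟨ m≡m%n+[m/n]*n (num * b ^ i) den ⟩
    num * b ^ i % den + ⌊num*b^ i /den⌋ * den    <⟨ +-monoˡ-< (⌊num*b^ i /den⌋ * den) (m%n<n (num * b ^ i) den) ⟩
    den + ⌊num*b^ i /den⌋ * den                  ∎
    where open ≤-Reasoning

  ⌊⌋≤b^ : num ≤ den → ∀ i → ⌊num*b^ i /den⌋ ≤ b ^ i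
  ⌊⌋≤b^ num≤den i = begin
    num * b ^ i / den    ≤⟨ /-monoˡ-≤ den (subst (num * b ^ i ≤_) (*-comm den (b ^ i)) (*-monoˡ-≤ (b ^ i) num≤den)) ⟩
    b ^ i * den / den    ≡⟨ m*n/n≡m (b ^ i) den ⟩
    b ^ i                ∎
    where open ≤-Reasoning

  ¬Below : ∀ n i → ⌊num*b^ i /den⌋ < trunc d n i → ¬ Below d n num den
  ¬Below n i ⌊⌋<t (k , below) = <-irrefl refl (begin-strict
    num * b ^ k * b ^ i            ≡⟨ [xy]z≡[xz]y num (b ^ k) (b ^ i) ⟩
    num * b ^ i * b ^ k            <⟨ *-monoˡ-< (b ^ k) {{m^n≢0 b k}} (<-≤-trans (<[1+⌊⌋]*den i) (*-monoˡ-≤ den ⌊⌋<t)) ⟩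
    t * den * b ^ k                ≡⟨ [xy]z≡[xz]y t den (b ^ k) ⟩
    t * b ^ k * den                ≤⟨ *-monoˡ-≤ den (trunc-cross d n i k) ⟩
    suc (trunc d n k) * b ^ i * den ≡⟨ [xy]z≡[xz]y (suc (trunc d n k)) (b ^ i) den ⟩
    suc (trunc d n k) * den * b ^ i <⟨ *-monoˡ-< (b ^ i) {{m^n≢0 b i}} below ⟩
    num * b ^ k * b ^ i            ∎)
    where
    open ≤-Reasoning
    t = trunc d n i

  -- Some later digit is not b - 1, which puts the point strictly below; as that digit cannot be
  -- located constructively, only ¬ ¬ Below follows.
  ¬¬Below : NotEventuallyMax d → ∀ n i → trunc d n i < ⌊num*b^ i /den⌋ → ¬ ¬ Below d n num den
  ¬¬Below notEventuallyMax n i t<⌊⌋ ¬below = notEventuallyMax (n + i , maximal)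
    where
    maximal : ∀ j → n + i ≤ j → toℕ (d j) ≡ b ∸ 1
    maximal j n+i≤j with toℕ (d j) ≟ b ∸ 1
    ... | yes dⱼ≡b-1 = dⱼ≡b-1
    ... | no  dⱼ≢b-1 = contradiction (i + suc r , below) ¬below
      where
      r = j ∸ (n + i)
      2+dⱼ≤b : 2 + toℕ (d (n + i + r)) ≤ b
      2+dⱼ≤b rewrite m+[n∸m]≡n n+i≤j = ≤∧≢⇒< (Fin.toℕ<n (d j)) (λ 1+dⱼ≡b → dⱼ≢b-1 (cong (_∸ 1) 1+dⱼ≡b))
      below : suc (trunc d n (i + suc r)) * den < num * b ^ (i + suc r)
      below = begin-strict
        suc (trunc d n (i + suc r)) * den          <⟨ *-monoˡ-< den (n<1+n (suc (trunc d n (i + suc r)))) ⟩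
        (2 + trunc d n (i + suc r)) * den          ≤⟨ *-monoˡ-≤ den (trunc-room d n i r 2+dⱼ≤b) ⟩
        suc (trunc d n i) * b ^ suc r * den        ≡⟨ [xy]z≡[xz]y (suc (trunc d n i)) (b ^ suc r) den ⟩
        suc (trunc d n i) * den * b ^ suc r        ≤⟨ *-monoˡ-≤ (b ^ suc r) (≤-trans (*-monoˡ-≤ den t<⌊⌋) (⌊⌋*den≤ i)) ⟩
        num * b ^ i * b ^ suc r                    ≡⟨ *-assoc num (b ^ i) (b ^ suc r) ⟩
        num * (b ^ i * b ^ suc r)                  ≡⟨ cong (num *_) (^-distribˡ-+-* b i (suc r)) ⟨
        num * b ^ (i + suc r)                      ∎
        where open ≤-Reasoning

-- Discrepancy of nested necklaces

module NestedBlocks {b : ℕ} .{{_ : NonZero b}} (d : ℕ → Fin b) where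

  SemiPerfectAt : ℕ → ℕ → ℕ → Set
  SemiPerfectAt j G s = Σ (List (Fin b)) λ w → SemiPerfect b j G w × Reads w (λ q → d (s + q))

  -- the block of length G bⁱ starting at s is an (i, G)-nested semi-perfect necklace
  NestedAt : ℕ → ℕ → ℕ → Set
  NestedAt G i s = ∀ j → 1 ≤ j → j ≤ i → ∀ t → suc t * (G * b ^ j) ≤ G * b ^ i →
                   SemiPerfectAt j G (s + t * (G * b ^ j))

  nestedAt-slice : ∀ {F G} s → NestedSemiPerfect b F G (slice d s (G * b ^ F)) → NestedAt G F s
  nestedAt-slice {F} {G} s nested j 1≤j j≤F t bound =
    w′ , nested j 1≤j j≤F t (subst (suc t * Lⱼ ≤_) (sym ∣slice∣) bound) , reads′
    where
    Lⱼ = G * b ^ j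
    w = slice d s (G * b ^ F)
    w′ = take Lⱼ (drop (t * Lⱼ) w)
    ∣slice∣ : length w ≡ G * b ^ F
    ∣slice∣ = trans (List.length-map _ (upTo (G * b ^ F))) (List.length-upTo (G * b ^ F))
    reads′ : Reads w′ (λ q → d (s + t * Lⱼ + q))
    reads′ q q<∣w′∣ = trans (take-reads Lⱼ (drop-reads (t * Lⱼ) (slice-reads d s (G * b ^ F))) q q<∣w′∣)
                            (cong (just ∘ d) (sym (+-assoc s (t * Lⱼ) q)))

  semiPerfectAt-top : ∀ {G i s} → NestedAt G (suc i) s → SemiPerfectAt (suc i) G s
  semiPerfectAt-top {G} {i} {s} nested =
    subst (SemiPerfectAt (suc i) G) (+-identityʳ s) (nested (suc i) (s≤s z≤n) ≤-refl 0 (≤-reflexive (+-identityʳ _)))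

  nestedAt-sub : ∀ {G i s u} → NestedAt G (suc i) s → u < b → NestedAt G i (s + u * (G * b ^ i))
  nestedAt-sub {G} {i} {s} {u} nested u<b j 1≤j j≤i t bound =
    subst (SemiPerfectAt j G) position (nested j 1≤j (m≤n⇒m≤1+n j≤i) t′ bound′)
    where
    Lⱼ = G * b ^ j
    Lᵢ = G * b ^ i
    B = b ^ (i ∸ j)
    t′ = u * B + t
    B*Lⱼ≡Lᵢ : B * Lⱼ ≡ Lᵢ
    B*Lⱼ≡Lᵢ = begin
      B * (G * b ^ j)      ≡⟨ x[yz]≡y[xz] B G (b ^ j) ⟩
      G * (B * b ^ j)      ≡⟨ cong (G *_) (^-distribˡ-+-* b (i ∸ j) j) ⟨
      G * b ^ (i ∸ j + j)  ≡⟨ cong (λ k → G * b ^ k) (m∸n+n≡m j≤i) ⟩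
      Lᵢ                   ∎
      where open ≡-Reasoning
    t′*Lⱼ≡ : ∀ t → (u * B + t) * Lⱼ ≡ u * Lᵢ + t * Lⱼ
    t′*Lⱼ≡ t = begin
      (u * B + t) * Lⱼ         ≡⟨ *-distribʳ-+ Lⱼ (u * B) t ⟩
      u * B * Lⱼ + t * Lⱼ      ≡⟨ cong (_+ t * Lⱼ) (trans (*-assoc u B Lⱼ) (cong (u *_) B*Lⱼ≡Lᵢ)) ⟩
      u * Lᵢ + t * Lⱼ          ∎
      where open ≡-Reasoning
    position : s + t′ * Lⱼ ≡ s + u * Lᵢ + t * Lⱼ
    position = trans (cong (λ x → s + x) (t′*Lⱼ≡ t)) (sym (+-assoc s (u * Lᵢ) (t * Lⱼ)))
    bound′ : suc t′ * Lⱼ ≤ G * b ^ suc i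
    bound′ = begin
      suc (u * B + t) * Lⱼ     ≡⟨ cong (_* Lⱼ) (sym (+-suc (u * B) t)) ⟩
      (u * B + suc t) * Lⱼ     ≡⟨ t′*Lⱼ≡ (suc t) ⟩
      u * Lᵢ + suc t * Lⱼ      ≤⟨ +-monoʳ-≤ (u * Lᵢ) bound ⟩
      u * Lᵢ + Lᵢ              ≡⟨ +-comm (u * Lᵢ) Lᵢ ⟩
      suc u * Lᵢ               ≤⟨ *-monoˡ-≤ Lᵢ u<b ⟩
      b * Lᵢ                   ≡⟨ x[yz]≡y[xz] b G (b ^ i) ⟩
      G * b ^ suc i            ∎
      where open ≤-Reasoning

module Discrepancy {b : ℕ} .{{_ : NonZero b}} (d : ℕ → Fin b)
                   (num den : ℕ) .{{_ : NonZero den}} (num≤den : num ≤ den)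
                   (N : ℕ) (χ : ℕ → ℕ) (χ≤1 : ∀ n → χ n ≤ 1)
                   (χ-lower : ∀ n i → n < N → 𝟙[ trunc d n i < num * b ^ i / den ] ≤ χ n)
                   (χ-upper : ∀ n i → n < N → χ n ≤ 𝟙[ trunc d n i < suc (num * b ^ i / den) ])
                   where

  open PointLocation d num den
  open NestedBlocks d

  count : ℕ → ℕ → ℕ
  count s L = ∑[ p < L ] χ (s + p)

  -- |count s L - L · num/den| ≤ E, cleared of denominators
  Balanced : ℕ → ℕ → ℕ → Set
  Balanced s L E = (count s L * den ≤ num * L + E * den) × (num * L ≤ (count s L + E) * den)

  Balanced-trivial : ∀ s L → Balanced s L L
  Balanced-trivial s L =
    ≤-trans (*-monoˡ-≤ den (∑-≤-length _ L (λ p → χ≤1 (s + p)))) (m≤n+m (L * den) (num * L)) ,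
    ≤-trans (subst (num * L ≤_) (*-comm den L) (*-monoˡ-≤ L num≤den)) (*-monoˡ-≤ den (m≤n+m L (count s L)))

  Balanced-weaken : ∀ {s L E E′} → E ≤ E′ → Balanced s L E → Balanced s L E′
  Balanced-weaken {s} {L} E≤E′ (upper , lower) =
    ≤-trans upper (+-monoʳ-≤ (num * L) (*-monoˡ-≤ den E≤E′)) ,
    ≤-trans lower (*-monoˡ-≤ den (+-monoʳ-≤ (count s L) E≤E′))

  Balanced-++ : ∀ {s L₁ L₂ E₁ E₂} → Balanced s L₁ E₁ → Balanced (s + L₁) L₂ E₂ →
                Balanced s (L₁ + L₂) (E₁ + E₂)
  Balanced-++ {s} {L₁} {L₂} {E₁} {E₂} (upper₁ , lower₁) (upper₂ , lower₂) = upper , lower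
    where
    c₁ = count s L₁
    c₂ = count (s + L₁) L₂
    count-++ : count s (L₁ + L₂) ≡ c₁ + c₂
    count-++ = trans (∑-split (λ p → χ (s + p)) L₁ L₂)
                     (cong (λ c → c₁ + c) (∑-cong L₂ (λ p _ → cong χ (sym (+-assoc s L₁ p)))))
    upper : count s (L₁ + L₂) * den ≤ num * (L₁ + L₂) + (E₁ + E₂) * den
    upper = begin
      count s (L₁ + L₂) * den                                  ≡⟨ cong (_* den) count-++ ⟩
      (c₁ + c₂) * den                                          ≡⟨ *-distribʳ-+ den c₁ c₂ ⟩
      c₁ * den + c₂ * den                                      ≤⟨ +-mono-≤ upper₁ upper₂ ⟩
      (num * L₁ + E₁ * den) + (num * L₂ + E₂ * den)            ≡⟨ regroup num L₁ L₂ E₁ E₂ den ⟩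
      num * (L₁ + L₂) + (E₁ + E₂) * den                        ∎
      where
      open ≤-Reasoning
      regroup : ∀ a x y p q r → (a * x + p * r) + (a * y + q * r) ≡ a * (x + y) + (p + q) * r
      regroup = solve-∀
    lower : num * (L₁ + L₂) ≤ (count s (L₁ + L₂) + (E₁ + E₂)) * den
    lower = begin
      num * (L₁ + L₂)                                          ≡⟨ *-distribˡ-+ num L₁ L₂ ⟩
      num * L₁ + num * L₂                                      ≤⟨ +-mono-≤ lower₁ lower₂ ⟩
      (c₁ + E₁) * den + (c₂ + E₂) * den                        ≡⟨ regroup c₁ c₂ E₁ E₂ den ⟩
      (c₁ + c₂ + (E₁ + E₂)) * den                              ≡⟨ cong (λ c → (c + (E₁ + E₂)) * den) count-++ ⟨
      (count s (L₁ + L₂) + (E₁ + E₂)) * den                    ∎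
      where
      open ≤-Reasoning
      regroup : ∀ x y p q r → (x + p) * r + (y + q) * r ≡ (x + y + (p + q)) * r
      regroup = solve-∀

  Balanced-semiPerfect : ∀ {i g s} → SemiPerfectAt i g s → s + g * b ^ i ≤ N → Balanced s (g * b ^ i) (i + g)
  Balanced-semiPerfect {i} {zero}      {s} _                  _     = Balanced-weaken {s} {0} {0} {i + 0} z≤n (Balanced-trivial s 0)
  Balanced-semiPerfect {i} {g@(suc _)} {s} (w , sp , reads) s+L≤N = upper , lower
    where
    instance
      L≢0 : NonZero (g * b ^ i)
      L≢0 = m*n≢0 g (b ^ i) {{_}} {{m^n≢0 b i}}
    open Necklace {w = w} sp reads using (L; count-below-lower; count-below-upper)
    P = ⌊num*b^ i /den⌋
    open ≤-Reasoning

    window : ∀ p → trunc (λ q → d (s + q)) p i ≡ trunc d (s + p) i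
    window p = trunc-cong _ d p (s + p) i (λ r _ → cong d (sym (+-assoc s p r)))

    χ-lower′ : ∀ p → p < L → 𝟙[ trunc (λ q → d (s + q)) p i < P ] ≤ χ (s + p)
    χ-lower′ p p<L rewrite window p = χ-lower (s + p) i (<-≤-trans (+-monoʳ-< s p<L) s+L≤N)

    χ-upper′ : ∀ p → p < L → χ (s + p) ≤ 𝟙[ trunc (λ q → d (s + q)) p i < suc P ]
    χ-upper′ p p<L rewrite window p = χ-upper (s + p) i (<-≤-trans (+-monoʳ-< s p<L) s+L≤N)

    upperCount : count s L ≤ suc P * g + i
    upperCount = ≤-trans (∑-mono-≤ L χ-upper′) (count-below-upper (suc P))

    upper : count s L * den ≤ num * L + (i + g) * den
    upper = begin
      count s L * den                      ≤⟨ *-monoˡ-≤ den upperCount ⟩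
      (suc P * g + i) * den                ≡⟨ regroup P g i den ⟩
      g * (P * den) + (i + g) * den        ≤⟨ +-monoˡ-≤ ((i + g) * den) (*-monoʳ-≤ g (⌊⌋*den≤ i)) ⟩
      g * (num * b ^ i) + (i + g) * den    ≡⟨ cong (_+ (i + g) * den) (x[yz]≡y[xz] g num (b ^ i)) ⟩
      num * L + (i + g) * den              ∎
      where
      regroup : ∀ P g i den → (suc P * g + i) * den ≡ g * (P * den) + (i + g) * den
      regroup = solve-∀

    lowerCount : P * g ≤ count s L + i
    lowerCount = ≤-trans (count-below-lower P (⌊⌋≤b^ num≤den i)) (+-monoˡ-≤ i (∑-mono-≤ L χ-lower′))

    lower : num * L ≤ (count s L + (i + g)) * den
    lower = begin
      num * L                              ≡⟨ x[yz]≡y[xz] num g (b ^ i) ⟩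
      g * (num * b ^ i)                    ≤⟨ *-monoʳ-≤ g (<⇒≤ (<[1+⌊⌋]*den i)) ⟩
      g * (suc P * den)                    ≡⟨ regroup g P den ⟩
      (P * g + g) * den                    ≤⟨ *-monoˡ-≤ den (+-monoˡ-≤ g lowerCount) ⟩
      (count s L + i + g) * den            ≡⟨ cong (_* den) (+-assoc (count s L) i g) ⟩
      (count s L + (i + g)) * den          ∎
      where
      regroup : ∀ g P den → g * (suc P * den) ≡ (P * g + g) * den
      regroup = solve-∀

  Balanced-nested : ∀ {G} i {s} → NestedAt G i s → s + G * b ^ i ≤ N → Balanced s (G * b ^ i) (i + G)
  Balanced-nested {G} zero    {s} _      _     = Balanced-weaken (≤-reflexive (*-identityʳ G)) (Balanced-trivial s (G * 1))
  Balanced-nested     (suc i)     nested bound = Balanced-semiPerfect (semiPerfectAt-top nested) bound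

  Balanced-replicate : ∀ {s L E} q → (∀ u → u < q → Balanced (s + u * L) L E) → Balanced s (q * L) (q * E)
  Balanced-replicate {s}         zero    _        = Balanced-trivial s 0
  Balanced-replicate {s} {L} {E} (suc q) balanced =
    Balanced-++ (subst (λ x → Balanced x L E) (+-identityʳ s) (balanced 0 (s≤s z≤n)))
                (Balanced-replicate q (λ u u<q →
                  subst (λ x → Balanced x L E) (sym (+-assoc s L (u * L))) (balanced (suc u) (s≤s u<q))))

  prefixError : ℕ → ℕ → ℕ
  prefixError G zero    = G
  prefixError G (suc i) = (b ∸ 1) * (i + G) + prefixError G i

  Balanced-prefix : ∀ {G} i {s R} → NestedAt G i s → R < G * b ^ i → s + R ≤ N → Balanced s R (prefixError G i)
  Balanced-prefix {G} zero    {s} {R} _      R<G*1 _      =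
    Balanced-weaken (≤-trans (<⇒≤ R<G*1) (≤-reflexive (*-identityʳ G))) (Balanced-trivial s R)
  Balanced-prefix {G} (suc i) {s} {R} nested R<Lᵢ₊₁ s+R≤N =
    Balanced-weaken (+-monoˡ-≤ (prefixError G i) (*-monoˡ-≤ (i + G) q≤b-1))
      (subst (λ x → Balanced s x (q * (i + G) + prefixError G i)) (sym R≡)
        (Balanced-++ (Balanced-replicate q full) rest))
    where
    L = G * b ^ i
    instance
      L≢0 : NonZero L
      L≢0 = m*n≢0 G (b ^ i) {{m*n≢0⇒m≢0 G {{ℕ.>-nonZero (≤-<-trans z≤n R<Lᵢ₊₁)}}}} {{m^n≢0 b i}}
    q = R / L
    q<b : q < b
    q<b = m<n*o⇒m/o<n (subst (R <_) (x[yz]≡y[xz] G b (b ^ i)) R<Lᵢ₊₁)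
    q≤b-1 : q ≤ b ∸ 1
    q≤b-1 = ≤-pred (subst (suc q ≤_) (sym (suc-pred b)) q<b)
    R≡ : R ≡ q * L + R % L
    R≡ = trans (m≡m%n+[m/n]*n R L) (+-comm (R % L) (q * L))
    s+qL+R%L≤N : s + q * L + R % L ≤ N
    s+qL+R%L≤N = subst (_≤ N) (trans (cong (λ x → s + x) R≡) (sym (+-assoc s (q * L) (R % L)))) s+R≤N
    full : ∀ u → u < q → Balanced (s + u * L) L (i + G)
    full u u<q = Balanced-nested i (nestedAt-sub nested (<-trans u<q q<b))
                                   (≤-trans bound (≤-trans (m≤m+n (s + q * L) (R % L)) s+qL+R%L≤N))
      where
      bound : s + u * L + L ≤ s + q * L
      bound = subst (_≤ s + q * L) (trans (cong (λ x → s + x) (+-comm L (u * L))) (sym (+-assoc s (u * L) L)))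
                    (+-monoʳ-≤ s (*-monoˡ-≤ L u<q))
    rest : Balanced (s + q * L) (R % L) (prefixError G i)
    rest = Balanced-prefix i (nestedAt-sub nested q<b) (m%n<n R L) s+qL+R%L≤N

  module _ (f g : ℕ → ℕ) (nested : ∀ j → 1 ≤ j → NestedSemiPerfect b (f j) (g j) (block d f g j)) where

    nestedAt-block : ∀ m → NestedAt (g (suc m)) (f (suc m)) (blockEnd b f g m)
    nestedAt-block m = nestedAt-slice (blockEnd b f g m) (nested (suc m) (s≤s z≤n))

    Balanced-blocks : ∀ m → blockEnd b f g m ≤ N → Balanced 0 (blockEnd b f g m) (sum1 f m + sum1 g m)
    Balanced-blocks zero    _     = Balanced-trivial 0 0
    Balanced-blocks (suc m) bound =
      subst (Balanced 0 (blockEnd b f g (suc m))) (+-interchange (sum1 f m) (sum1 g m) (f (suc m)) (g (suc m)))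
        (Balanced-++ (Balanced-blocks m (≤-trans (m≤m+n _ _) bound))
                     (Balanced-nested (f (suc m)) (nestedAt-block m) bound))

    Balanced-initial : ∀ m → blockEnd b f g m ≤ N → N < blockEnd b f g (suc m) →
                       Balanced 0 N (sum1 f m + sum1 g m + prefixError (g (suc m)) (f (suc m)))
    Balanced-initial m S≤N N<S′ =
      subst (λ L → Balanced 0 L (sum1 f m + sum1 g m + prefixError (g (suc m)) (f (suc m)))) (m+[n∸m]≡n S≤N)
        (Balanced-++ (Balanced-blocks m S≤N)
                     (Balanced-prefix (f (suc m)) (nestedAt-block m) R<L (≤-reflexive (m+[n∸m]≡n S≤N))))
      where
      S = blockEnd b f g m
      R<L : N ∸ S < g (suc m) * b ^ f (suc m)
      R<L = +-cancelˡ-< S (N ∸ S) _ (subst (_< S + g (suc m) * b ^ f (suc m)) (sym (m+[n∸m]≡n S≤N)) N<S′)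

  2*prefixError : ∀ G i → 2 * prefixError G i + (b ∸ 1) * i ≡ 2 * G + 2 * ((b ∸ 1) * i * G) + (b ∸ 1) * (i * i)
  2*prefixError G zero    = regroup (b ∸ 1) G
    where
    regroup : ∀ B G → 2 * G + B * 0 ≡ 2 * G + 2 * (B * 0 * G) + B * (0 * 0)
    regroup = solve-∀
  2*prefixError G (suc i) = begin
    2 * ((b ∸ 1) * (i + G) + prefixError G i) + (b ∸ 1) * suc i
      ≡⟨ regroup₁ (b ∸ 1) i G (prefixError G i) ⟩
    (2 * prefixError G i + (b ∸ 1) * i) + (2 * ((b ∸ 1) * (i + G)) + (b ∸ 1))
      ≡⟨ cong (_+ (2 * ((b ∸ 1) * (i + G)) + (b ∸ 1))) (2*prefixError G i) ⟩
    (2 * G + 2 * ((b ∸ 1) * i * G) + (b ∸ 1) * (i * i)) + (2 * ((b ∸ 1) * (i + G)) + (b ∸ 1))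
      ≡⟨ regroup₂ (b ∸ 1) i G ⟩
    2 * G + 2 * ((b ∸ 1) * suc i * G) + (b ∸ 1) * (suc i * suc i)   ∎
    where
    open ≡-Reasoning
    regroup₁ : ∀ B i G E → 2 * (B * (i + G) + E) + B * suc i ≡ (2 * E + B * i) + (2 * (B * (i + G)) + B)
    regroup₁ = solve-∀
    regroup₂ : ∀ B i G → (2 * G + 2 * (B * i * G) + B * (i * i)) + (2 * (B * (i + G)) + B) ≡
                         2 * G + 2 * (B * suc i * G) + B * (suc i * suc i)
    regroup₂ = solve-∀

  2*initialError≤ : ∀ a c G F → 2 * (a + c + prefixError G F) ≤ 2 * (a + (c + G) + (b ∸ 1) * F * G) + (b ∸ 1) * (F * F)
  2*initialError≤ a c G F = begin
    2 * (a + c + E)                                                   ≤⟨ m≤m+n (2 * (a + c + E)) ((b ∸ 1) * F) ⟩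
    2 * (a + c + E) + (b ∸ 1) * F                                     ≡⟨ regroup₁ a c E ((b ∸ 1) * F) ⟩
    2 * (a + c) + (2 * E + (b ∸ 1) * F)                               ≡⟨ cong (λ x → 2 * (a + c) + x) (2*prefixError G F) ⟩
    2 * (a + c) + (2 * G + 2 * ((b ∸ 1) * F * G) + (b ∸ 1) * (F * F))  ≡⟨ regroup₂ a c G (b ∸ 1) F ⟩
    2 * (a + (c + G) + (b ∸ 1) * F * G) + (b ∸ 1) * (F * F)           ∎
    where
    open ≤-Reasoning
    E = prefixError G F
    regroup₁ : ∀ a c e z → 2 * (a + c + e) + z ≡ 2 * (a + c) + (2 * e + z)
    regroup₁ = solve-∀
    regroup₂ : ∀ a c G B F → 2 * (a + c) + (2 * G + 2 * (B * F * G) + B * (F * F)) ≡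
                             2 * (a + (c + G) + B * F * G) + B * (F * F)
    regroup₂ = solve-∀

module _ {b : ℕ} .{{_ : NonZero b}} (d : ℕ → Fin b) (notEventuallyMax : NotEventuallyMax d)
         (num den : ℕ) .{{_ : NonZero den}} {N : ℕ} (A : Subset N)
         (A≡below : ∀ (i : Fin N) → i ∈ A ⇔ Below d (toℕ i) num den) where

  open PointLocation d num den

  private
    𝟙∈-below : ∀ {n} → n < N → ¬ ¬ Below d n num den → 𝟙∈ A n ≡ 1
    𝟙∈-below n<N ¬¬below with fromℕ< n<N | Fin.toℕ-fromℕ< n<N
    ... | i | refl with i ∈? A
    ...   | yes i∈A = 𝟙∈-∈ A i i∈A
    ...   | no  i∉A = contradiction (i∉A ∘ Equivalence.from (A≡below i)) ¬¬below

    𝟙∈-¬below : ∀ {n} → n < N → ¬ Below d n num den → 𝟙∈ A n ≡ 0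
    𝟙∈-¬below n<N ¬below with fromℕ< n<N | Fin.toℕ-fromℕ< n<N
    ... | i | refl = 𝟙∈-∉ A i (¬below ∘ Equivalence.to (A≡below i))

  𝟙∈-lower : ∀ n i → n < N → 𝟙[ trunc d n i < ⌊num*b^ i /den⌋ ] ≤ 𝟙∈ A n
  𝟙∈-lower n i n<N with trunc d n i <? ⌊num*b^ i /den⌋
  ... | no  t≮⌊⌋ rewrite dec-false (trunc d n i <? ⌊num*b^ i /den⌋) t≮⌊⌋ = z≤n
  ... | yes t<⌊⌋ rewrite dec-true (trunc d n i <? ⌊num*b^ i /den⌋) t<⌊⌋ =
    ≤-reflexive (sym (𝟙∈-below n<N (¬¬Below notEventuallyMax n i t<⌊⌋)))

  𝟙∈-upper : ∀ n i → n < N → 𝟙∈ A n ≤ 𝟙[ trunc d n i < suc ⌊num*b^ i /den⌋ ]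
  𝟙∈-upper n i n<N with trunc d n i <? suc ⌊num*b^ i /den⌋
  ... | yes t<1+⌊⌋ rewrite dec-true (trunc d n i <? suc ⌊num*b^ i /den⌋) t<1+⌊⌋ = 𝟙∈≤1 A n
  ... | no  t≮1+⌊⌋ rewrite dec-false (trunc d n i <? suc ⌊num*b^ i /den⌋) t≮1+⌊⌋ =
    ≤-reflexive (𝟙∈-¬below n<N (¬Below n i (≮⇒≥ t≮1+⌊⌋)))

theorem1 : (b : ℕ) → 2 ≤ b → (f g : ℕ → ℕ) → (d : ℕ → Fin b) →
    NotEventuallyMax d →
    ((n : ℕ) → ∃ λ j → n < blockEnd b f g j) →
    ((j : ℕ) → 1 ≤ j → NestedSemiPerfect b (f j) (g j) (block d f g j)) →
    (N m : ℕ) → blockEnd b f g (m ∸ 1) ≤ N → N < blockEnd b f g m →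
    (c : ℚ) → Q.0ℚ Q.< c → c Q.≤ Q.1ℚ →
    (A : Subset N) → ((i : Fin N) → (i ∈ A) ⇔ PointBelow d (toℕ i) c) →
    Q.∣ ℕtoℚ (∣ A ∣) Q.- ℕtoℚ N Q.* c ∣
      Q.≤ ℕtoℚ (sum1 f (m ∸ 1) + sum1 g m + (b ∸ 1) * f m * g m)
        Q.+ (+ ((b ∸ 1) * (f m * f m))) Q./ 2
theorem1 b 2≤b f g d notEventuallyMax _ nested N zero    _   ()
theorem1 b 2≤b f g d notEventuallyMax _ nested N (suc m) _   _    (mkℚ -[1+ _ ] _ _) (Q.*<* ()) _ _ _
theorem1 b 2≤b f g d notEventuallyMax _ nested N (suc m) S≤N N<S′ c@(mkℚ (+ num) den-1 _) _ c≤1 A A≡pointBelow =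
  Q.≤-trans (∣a-n*c∣≤e c num den c*den≡num ∣ A ∣ N E upper lower)
            (2*m≤2*n+k⇒m≤n+k/2 E (sum1 f m + sum1 g (suc m) + (b ∸ 1) * F * G) ((b ∸ 1) * (F * F))
                                 (2*initialError≤ (sum1 f m) (sum1 g m) G F))
  where
  instance
    b≢0 : NonZero b
    b≢0 = ℕ.>-nonZero (≤-trans (s≤s z≤n) 2≤b)
  F = f (suc m)
  G = g (suc m)
  den = suc den-1
  c*den≡num : c Q.* ℕtoℚ den ≡ ℕtoℚ num
  c*den≡num = mkℚ*den≡num num den-1 _
  A≡below : ∀ i → i ∈ A ⇔ Below d (toℕ i) num den
  A≡below i = PointBelow⇔Below d c num den c*den≡num (toℕ i) ⇔-∘ A≡pointBelow i
  open Discrepancy d num den (mkℚ≤1⇒num≤den num den-1 _ c≤1) N (𝟙∈ A) (𝟙∈≤1 A)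
                   (𝟙∈-lower d notEventuallyMax num den A A≡below) (𝟙∈-upper d notEventuallyMax num den A A≡below)
  E = sum1 f m + sum1 g m + prefixError G F
  balanced : Balanced 0 N E
  balanced = Balanced-initial f g nested m S≤N N<S′
  upper : ∣ A ∣ * den ≤ num * N + E * den
  upper = subst (λ a → a * den ≤ num * N + E * den) (sym (∣A∣≡∑𝟙∈ A)) (proj₁ balanced)
  lower : num * N ≤ (∣ A ∣ + E) * den
  lower = subst (λ a → num * N ≤ (a + E) * den) (sym (∣A∣≡∑𝟙∈ A)) (proj₂ balanced)
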